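{- Let $G$ be a graph and let $f$ be a vertex-arithmetic IASI of $G$. Then $f$ is an arithmetic IASI of $G$ if and only if for any two adjacent vertices $u,v$ of $G$, the deterministic index of one of them, say $v$, equals $k$ times the deterministic index of the other, $u$, for some positive integer $k$ with $k\le |f(u)|$.
   Context: All graphs are simple, finite and have no isolated vertices. $\mathbb{N}_0$ is the set of non-negative integers; all sets considered are finite. For $A,B\subseteq\mathbb{N}_0$, $A+B=\{a+b: a\in A, b\in B\}$. An integer additive set-indexer (IASI) of $G$ is an injective function $f:V(G)\to 2^{\mathbb{N}_0}$ such that the induced function $f^+:E(G)\to 2^{\mathbb{N}_0}$, $f^+(uv)=f(u)+f(v)$, is also injective. An AP-set is a finite set of non-negative integers whose elements, in increasing order, form an arithmetic progression; its common difference is called the deterministic index of the element (vertex or edge) it labels. An IASI $f$ is vertex-arithmetic if $f(v)$ is an AP-set for every vertex $v$, edge-arithmetic if $f^+(e)$ is an AP-set for every edge $e$, and an arithmetic IASI if it is both. -}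

module Defs where

open import Data.Nat using (ℕ; _+_; _*_; _≤_; _<_; _≟_)
open import Data.Fin using (Fin)
open import Data.List using (List; length; deduplicate; concatMap; map)
open import Data.List.Membership.Propositional using (_∈_)
open import Data.Product using (Σ; ∃; _×_; _,_)
open import Data.Sum using (_⊎_)
open import Function.Bundles using (_⇔_)
open import Relation.Binary.PropositionalEquality using (_≡_)
open import Relation.Nullary using (¬_)

-- A finite subset of ℕ₀ is represented by a list of its elements
-- (duplicates/order irrelevant); two such are the same set iff they
-- have the same members.
FinSet : Set
FinSet = List ℕ

_≋_ : FinSet → FinSet → Set
A ≋ B = ∀ x → (x ∈ A) ⇔ (x ∈ B)

∣_∣ₛ : FinSet → ℕ
∣ A ∣ₛ = length (deduplicate _≟_ A)

_⊕_ : FinSet → FinSet → FinSet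
A ⊕ B = concatMap (λ a → map (a +_) B) A

IsAPWith : FinSet → ℕ → ℕ → ℕ → Set
IsAPWith A a d m = (2 ≤ m) × (1 ≤ d) × (∀ x → (x ∈ A) ⇔ (Σ ℕ λ i → (i < m) × (x ≡ a + i * d)))

HasDetIndex : FinSet → ℕ → Set
HasDetIndex A d = Σ ℕ λ a → Σ ℕ λ m → IsAPWith A a d m

IsAPSet : FinSet → Set
IsAPSet A = Σ ℕ λ d → HasDetIndex A d

record Graph (n : ℕ) : Set₁ where
  field
    Adj       : Fin n → Fin n → Set
    symmetric : ∀ {u v} → Adj u v → Adj v u
    irrefl    : ∀ {u} → ¬ Adj u u
    noIsolated : ∀ u → ∃ λ v → Adj u v

open Graph public

record IsIASI {n : ℕ} (G : Graph n) (f : Fin n → FinSet) : Set where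
  field
    vertexInjective : ∀ u v → f u ≋ f v → u ≡ v
    edgeInjective   : ∀ u v x y → Adj G u v → Adj G x y →
                      (f u ⊕ f v) ≋ (f x ⊕ f y) →
                      ((u ≡ x) × (v ≡ y)) ⊎ ((u ≡ y) × (v ≡ x))

IsVertexArithmetic : ∀ {n} → Graph n → (Fin n → FinSet) → Set
IsVertexArithmetic G f = ∀ v → IsAPSet (f v)

IsEdgeArithmetic : ∀ {n} → Graph n → (Fin n → FinSet) → Set
IsEdgeArithmetic G f = ∀ u v → Adj G u v → IsAPSet (f u ⊕ f v)

IsArithmetic : ∀ {n} → Graph n → (Fin n → FinSet) → Set
IsArithmetic G f = IsVertexArithmetic G f × IsEdgeArithmetic G f

module Submission where

-- Write A = a + {0, …, m-1}·du and B = b + {0, …, n-1}·dv with du ≤ dv. Then A ⊕ B = (a + b) + X with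
-- X = {i·du + j·dv : i < m, j < n}, and A ⊕ B is an AP exactly when X is an AP starting at 0. If it is,
-- its difference is the least nonzero element du of X, and dv ∈ X forces dv = k·du. Moreover k ≤ m,
-- for otherwise m·du would lie in X without being of the form (i + j·k)·du with i < m. Conversely, if
-- dv = k·du with k ≤ m, then X = {t·du : t < m + (n-1)·k}, since the blocks {i + j·k : i < m} of
-- consecutive integers overlap or abut.

open import Defs
open import Data.Nat
  using (ℕ; zero; suc; _+_; _*_; _∸_; _≤_; _<_; _≟_; _<?_; z≤n; s≤s; s≤s⁻¹; z<s; >-nonZero)
open import Data.Nat.Properties
open import Algebra.Properties.CommutativeSemigroup +-commutativeSemigroup
  using () renaming (interchange to +-interchange)
open import Data.Fin using (Fin)
open import Data.List using (length; map; upTo; deduplicate)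
open import Data.List.Properties using (length-map; length-applyUpTo)
open import Data.List.Membership.Propositional using (_∈_; find; lose)
open import Data.List.Membership.Propositional.Properties
  using (∈-map⁺; ∈-map⁻; ∈-upTo⁺; ∈-upTo⁻; deduplicate-∈⇔; ∈-concatMap⁺; ∈-concatMap⁻)
open import Data.List.Membership.Propositional.Properties.WithK using (unique∧set⇒bag)
open import Data.List.Relation.Unary.Unique.Propositional using (Unique)
open import Data.List.Relation.Unary.Unique.Propositional.Properties using (map⁺; upTo⁺)
open import Data.List.Relation.Unary.Unique.DecPropositional.Properties _≟_ using (deduplicate-!)
open import Data.List.Relation.Binary.BagAndSetEquality using (∼bag⇒↭)
open import Data.List.Relation.Binary.Permutation.Propositional.Properties using (↭-length)
open import Data.Product using (Σ; _×_; _,_; proj₂)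
open import Data.Sum using (_⊎_; inj₁; inj₂)
open import Function using (_∘_)
open import Function.Bundles using (_⇔_; mk⇔; Equivalence)
open import Function.Construct.Composition using (_⇔-∘_)
open import Function.Construct.Symmetry using (⇔-sym)
open import Relation.Nullary using (¬_; yes; no; contradiction)
open import Relation.Binary.PropositionalEquality

open Equivalence using (to; from)

∣∣ₛ-IsAPWith : ∀ {A a d m} → IsAPWith A a d m → ∣ A ∣ₛ ≡ m
∣∣ₛ-IsAPWith {A} {a} {d} {m} (_ , 1≤d , mem) = begin
  ∣ A ∣ₛ                     ≡⟨ ↭-length (∼bag⇒↭ (unique∧set⇒bag (deduplicate-! A) terms-unique sameMembers)) ⟩
  length (map term (upTo m)) ≡⟨ length-map term (upTo m) ⟩
  length (upTo m)            ≡⟨ length-applyUpTo (λ i → i) m ⟩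
  m                          ∎
  where
  open ≡-Reasoning
  term : ℕ → ℕ
  term i = a + i * d
  term-injective : ∀ {i j} → term i ≡ term j → i ≡ j
  term-injective {i} {j} eq = *-cancelʳ-≡ i j d {{>-nonZero 1≤d}} (+-cancelˡ-≡ a _ _ eq)
  terms-unique : Unique (map term (upTo m))
  terms-unique = map⁺ term-injective (upTo⁺ m)
  sameMembers : ∀ {x} → (x ∈ deduplicate _≟_ A) ⇔ (x ∈ map term (upTo m))
  sameMembers {x} = mk⇔ toTerms fromTerms
    where
    toTerms : x ∈ deduplicate _≟_ A → x ∈ map term (upTo m)
    toTerms x∈ with to (mem x) (from (deduplicate-∈⇔ _≟_) x∈)
    ... | i , i<m , refl = ∈-map⁺ term (∈-upTo⁺ i<m)
    fromTerms : x ∈ map term (upTo m) → x ∈ deduplicate _≟_ A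
    fromTerms x∈ with ∈-map⁻ term x∈
    ... | i , i∈ , refl = to (deduplicate-∈⇔ _≟_) (from (mem x) (i , ∈-upTo⁻ i∈ , refl))

∈-⊕⁺ : ∀ {A B a b} → a ∈ A → b ∈ B → a + b ∈ A ⊕ B
∈-⊕⁺ {B = B} {a} a∈A b∈B = ∈-concatMap⁺ (λ a′ → map (a′ +_) B) (lose a∈A (∈-map⁺ (a +_) b∈B))

∈-⊕⁻ : ∀ {A B x} → x ∈ A ⊕ B → Σ ℕ λ a → Σ ℕ λ b → a ∈ A × b ∈ B × x ≡ a + b
∈-⊕⁻ {A} {B} x∈ with find (∈-concatMap⁻ (λ a → map (a +_) B) {xs = A} x∈)
... | a , a∈A , x∈a+B with ∈-map⁻ (a +_) x∈a+B
... | b , b∈B , x≡a+b = a , b , a∈A , b∈B , x≡a+b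

Shift : ℕ → (ℕ → Set) → ℕ → Set
Shift s P x = Σ ℕ λ y → P y × x ≡ s + y

Shift-cong : ∀ {s} {P Q : ℕ → Set} → (∀ y → P y ⇔ Q y) → ∀ x → Shift s P x ⇔ Shift s Q x
Shift-cong P⇔Q x = mk⇔ (λ (y , py , eq) → y , to (P⇔Q y) py , eq)
                       (λ (y , qy , eq) → y , from (P⇔Q y) qy , eq)

Shift-start-≤ : ∀ {s t} {P Q : ℕ → Set} → P 0 → (∀ x → Shift s P x → Shift t Q x) → t ≤ s
Shift-start-≤ {s} {t} p0 P⊆Q with P⊆Q (s + 0) (0 , p0 , refl)
... | y , _ , eq = subst (t ≤_) (trans (sym eq) (+-identityʳ s)) (m≤m+n t y)

Shift-reflect : ∀ {s} {P Q : ℕ → Set} → (∀ x → Shift s P x → Shift s Q x) → ∀ y → P y → Q y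
Shift-reflect {s} P⊆Q y py with P⊆Q (s + y) (y , py , refl)
... | y′ , qy′ , eq = subst _ (sym (+-cancelˡ-≡ s y y′ eq)) qy′

Shift-injective : ∀ {s t} {P Q : ℕ → Set} → P 0 → Q 0 → (∀ x → Shift s P x ⇔ Shift t Q x) →
                  s ≡ t × (∀ y → P y ⇔ Q y)
Shift-injective {s} {t} {P} {Q} p0 q0 P≈Q = s≡t , λ y → mk⇔ (Shift-reflect P⊆Q y) (Shift-reflect Q⊆P y)
  where
  s≡t : s ≡ t
  s≡t = ≤-antisym (Shift-start-≤ q0 (λ x → from (P≈Q x))) (Shift-start-≤ p0 (λ x → to (P≈Q x)))
  P⊆Q : ∀ x → Shift s P x → Shift s Q x
  P⊆Q x = subst (λ r → Shift r Q x) (sym s≡t) ∘ to (P≈Q x)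
  Q⊆P : ∀ x → Shift s Q x → Shift s P x
  Q⊆P x = from (P≈Q x) ∘ subst (λ r → Shift r Q x) s≡t

APOffset : ℕ → ℕ → ℕ → Set
APOffset d p y = Σ ℕ λ t → (t < p) × (y ≡ t * d)

SumOffset : ℕ → ℕ → ℕ → ℕ → ℕ → Set
SumOffset du m dv n y = Σ ℕ λ i → Σ ℕ λ j → (i < m) × (j < n) × (y ≡ i * du + j * dv)

AP⇔Shift-APOffset : ∀ a d m x → (Σ ℕ λ i → (i < m) × (x ≡ a + i * d)) ⇔ Shift a (APOffset d m) x
AP⇔Shift-APOffset a d m x = mk⇔ (λ (i , i<m , eq) → i * d , (i , i<m , refl) , eq)
                                (λ { (_ , (i , i<m , refl) , eq) → i , i<m , eq })

∈-⊕-IsAPWith : ∀ {A B a du m b dv n} → IsAPWith A a du m → IsAPWith B b dv n →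
               ∀ x → (x ∈ A ⊕ B) ⇔ Shift (a + b) (SumOffset du m dv n) x
∈-⊕-IsAPWith {A} {B} {a} {du} {m} {b} {dv} {n} (_ , _ , memA) (_ , _ , memB) x = mk⇔ toShift fromShift
  where
  regroup : ∀ i j → (a + i * du) + (b + j * dv) ≡ (a + b) + (i * du + j * dv)
  regroup i j = +-interchange a (i * du) b (j * dv)
  toShift : x ∈ A ⊕ B → Shift (a + b) (SumOffset du m dv n) x
  toShift x∈ with ∈-⊕⁻ {A} {B} x∈
  ... | a′ , b′ , a′∈A , b′∈B , refl with to (memA a′) a′∈A | to (memB b′) b′∈B
  ... | i , i<m , refl | j , j<n , refl = i * du + j * dv , (i , j , i<m , j<n , refl) , regroup i j
  fromShift : Shift (a + b) (SumOffset du m dv n) x → x ∈ A ⊕ B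
  fromShift (_ , (i , j , i<m , j<n , refl) , refl) =
    subst (_∈ A ⊕ B) (regroup i j)
          (∈-⊕⁺ (from (memA _) (i , i<m , refl)) (from (memB _) (j , j<n , refl)))

SumOffset-swap : ∀ {du m dv n} y → SumOffset du m dv n y ⇔ SumOffset dv n du m y
SumOffset-swap {du} {dv = dv} y = mk⇔
  (λ (i , j , i<m , j<n , eq) → j , i , j<n , i<m , trans eq (+-comm (i * du) (j * dv)))
  (λ (j , i , j<n , i<m , eq) → i , j , i<m , j<n , trans eq (+-comm (j * dv) (i * du)))

-- The offsets of A ⊕ B from its minimum a + b form an AP (necessarily starting at 0).
OffsetsAP : ℕ → ℕ → ℕ → ℕ → Set
OffsetsAP du m dv n =
  Σ ℕ λ d → Σ ℕ λ p → (2 ≤ p) × (1 ≤ d) × (∀ y → SumOffset du m dv n y ⇔ APOffset d p y)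

⊕-IsAPSet⇔OffsetsAP : ∀ {A B a du m b dv n} → IsAPWith A a du m → IsAPWith B b dv n →
                      IsAPSet (A ⊕ B) ⇔ OffsetsAP du m dv n
⊕-IsAPSet⇔OffsetsAP {A} {B} {a} {du} {m} {b} {dv} {n} apA@(2≤m , _) apB@(2≤n , _) =
  mk⇔ toOffsets fromOffsets
  where
  toOffsets : IsAPSet (A ⊕ B) → OffsetsAP du m dv n
  toOffsets (d , c , p , 2≤p , 1≤d , memC) = d , p , 2≤p , 1≤d , proj₂ (Shift-injective sum₀ ap₀ sameShifts)
    where
    sum₀ : SumOffset du m dv n 0
    sum₀ = 0 , 0 , ≤-trans z<s 2≤m , ≤-trans z<s 2≤n , refl
    ap₀ : APOffset d p 0
    ap₀ = 0 , ≤-trans z<s 2≤p , refl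
    sameShifts : ∀ x → Shift (a + b) (SumOffset du m dv n) x ⇔ Shift c (APOffset d p) x
    sameShifts x = AP⇔Shift-APOffset c d p x ⇔-∘ (memC x ⇔-∘ ⇔-sym (∈-⊕-IsAPWith apA apB x))
  fromOffsets : OffsetsAP du m dv n → IsAPSet (A ⊕ B)
  fromOffsets (d , p , 2≤p , 1≤d , offsets) =
    d , a + b , p , 2≤p , 1≤d , λ x →
      ⇔-sym (AP⇔Shift-APOffset (a + b) d p x) ⇔-∘ (Shift-cong offsets x ⇔-∘ ∈-⊕-IsAPWith apA apB x)

OffsetsAP-swap : ∀ {du m dv n} → OffsetsAP du m dv n → OffsetsAP dv n du m
OffsetsAP-swap (d , p , 2≤p , 1≤d , offsets) = d , p , 2≤p , 1≤d , λ y → offsets y ⇔-∘ SumOffset-swap y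

BoundedMultiple : ℕ → ℕ → ℕ → Set
BoundedMultiple m d d′ = Σ ℕ λ k → (1 ≤ k) × (k ≤ m) × (d′ ≡ k * d)

i*d+j*[k*d]≡[i+j*k]*d : ∀ i j k d → i * d + j * (k * d) ≡ (i + j * k) * d
i*d+j*[k*d]≡[i+j*k]*d i j k d = begin
  i * d + j * (k * d) ≡⟨ cong (i * d +_) (*-assoc j k d) ⟨
  i * d + j * k * d   ≡⟨ *-distribʳ-+ d i (j * k) ⟨
  (i + j * k) * d     ∎
  where open ≡-Reasoning

≤-of-positive-multiple : ∀ {x d} t → 1 ≤ x → x ≡ t * d → d ≤ x
≤-of-positive-multiple zero 1≤x refl = contradiction 1≤x λ ()
≤-of-positive-multiple {d = d} (suc t) _ refl = m≤m+n d (t * d)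

i+j*k≢m : ∀ {i m k} j → i < m → m < k → i + j * k ≢ m
i+j*k≢m {i} zero i<m _ eq = <-irrefl (trans (sym (+-identityʳ i)) eq) i<m
i+j*k≢m {i} {k = k} (suc j) _ m<k eq = <⇒≱ m<k (subst (k ≤_) eq (≤-trans (m≤m+n k (j * k)) (m≤n+m _ i)))

module SumOffsetsAsAP {du m dv n d p : ℕ}
  (1≤du : 1 ≤ du) (du≤dv : du ≤ dv) (2≤m : 2 ≤ m) (2≤n : 2 ≤ n) (2≤p : 2 ≤ p) (1≤d : 1 ≤ d)
  (offsets : ∀ y → SumOffset du m dv n y ⇔ APOffset d p y) where

  APOffset-of : ∀ i j → i < m → j < n → APOffset d p (i * du + j * dv)
  APOffset-of i j i<m j<n = to (offsets _) (i , j , i<m , j<n , refl)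

  SumOffset-of : ∀ t → t < p → SumOffset du m dv n (t * d)
  SumOffset-of t t<p = from (offsets _) (t , t<p , refl)

  du≤nonzero-offset : ∀ i j → 1 ≤ i * du + j * dv → du ≤ i * du + j * dv
  du≤nonzero-offset zero    zero    ()
  du≤nonzero-offset zero    (suc j) _ = ≤-trans du≤dv (m≤m+n dv (j * dv))
  du≤nonzero-offset (suc i) j       _ = ≤-trans (m≤m+n du (i * du)) (m≤m+n _ (j * dv))

  d≡du : d ≡ du
  d≡du = ≤-antisym d≤du du≤d
    where
    d≤du : d ≤ du
    d≤du with APOffset-of 1 0 2≤m (≤-trans z<s 2≤n)
    ... | t , _ , eq =
      ≤-of-positive-multiple t 1≤du (trans (sym (trans (+-identityʳ _) (*-identityˡ du))) eq)
    du≤d : du ≤ d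
    du≤d with SumOffset-of 1 2≤p
    ... | i , j , _ , _ , eq =
      subst (du ≤_) (sym d≡offset) (du≤nonzero-offset i j (subst (1 ≤_) d≡offset 1≤d))
      where
      d≡offset : d ≡ i * du + j * dv
      d≡offset = trans (sym (*-identityˡ d)) eq

  dv-multiple : Σ ℕ λ k → (k < p) × (dv ≡ k * du)
  dv-multiple with APOffset-of 0 1 (≤-trans z<s 2≤m) 2≤n
  ... | k , k<p , eq = k , k<p , trans (sym (+-identityʳ dv)) (trans eq (cong (k *_) d≡du))

  1≤k : ∀ k → dv ≡ k * du → 1 ≤ k
  1≤k zero    eq = contradiction (subst (1 ≤_) eq (≤-trans 1≤du du≤dv)) λ ()
  1≤k (suc _) _  = s≤s z≤n

  k≤m : ∀ k → k < p → dv ≡ k * du → k ≤ m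
  k≤m k k<p dv≡k*du = ≮⇒≥ m≮k
    where
    m≮k : ¬ m < k
    m≮k m<k with SumOffset-of m (<-trans m<k k<p)
    ... | i , j , i<m , _ , eq =
      i+j*k≢m j i<m m<k (sym (*-cancelʳ-≡ m (i + j * k) du {{>-nonZero 1≤du}} m*du≡))
      where
      open ≡-Reasoning
      m*du≡ : m * du ≡ (i + j * k) * du
      m*du≡ = begin
        m * du                ≡⟨ cong (m *_) d≡du ⟨
        m * d                 ≡⟨ eq ⟩
        i * du + j * dv       ≡⟨ cong (λ e → i * du + j * e) dv≡k*du ⟩
        i * du + j * (k * du) ≡⟨ i*d+j*[k*d]≡[i+j*k]*d i j k du ⟩
        (i + j * k) * du      ∎

  boundedMultiple : BoundedMultiple m du dv
  boundedMultiple with dv-multiple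
  ... | k , k<p , dv≡k*du = k , 1≤k k dv≡k*du , k≤m k k<p dv≡k*du , dv≡k*du

OffsetsAP⇒BoundedMultiple : ∀ {du m dv n} → 1 ≤ du → du ≤ dv → 2 ≤ m → 2 ≤ n →
                            OffsetsAP du m dv n → BoundedMultiple m du dv
OffsetsAP⇒BoundedMultiple 1≤du du≤dv 2≤m 2≤n (_ , _ , 2≤p , 1≤d , offsets) =
  SumOffsetsAsAP.boundedMultiple 1≤du du≤dv 2≤m 2≤n 2≤p 1≤d offsets

i+j*k-cover : ∀ {m k} n t → k ≤ m → t < m + n * k →
              Σ ℕ λ i → Σ ℕ λ j → (i < m) × (j ≤ n) × (t ≡ i + j * k)
i+j*k-cover {m} zero t _ t<m+0 = t , 0 , subst (t <_) (+-identityʳ m) t<m+0 , z≤n , sym (+-identityʳ t)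
i+j*k-cover {m} {k} (suc n) t k≤m t< with t <? m + n * k
... | yes t<′ with i+j*k-cover n t k≤m t<′
...   | i , j , i<m , j≤n , eq = i , j , i<m , m≤n⇒m≤1+n j≤n , eq
i+j*k-cover {m} {k} (suc n) t k≤m t< | no t≮ =
  t ∸ suc n * k , suc n , +-cancelʳ-< (suc n * k) _ m (subst (_< m + suc n * k) t≡ t<) , ≤-refl , t≡
  where
  t≡ : t ≡ t ∸ suc n * k + suc n * k
  t≡ = sym (m∸n+n≡m (≤-trans (+-monoˡ-≤ (n * k) k≤m) (≮⇒≥ t≮)))

SumOffset⇔APOffset-multiple : ∀ {du m k} n y → k ≤ m →
                              SumOffset du m (k * du) (suc n) y ⇔ APOffset du (m + n * k) y
SumOffset⇔APOffset-multiple {du} {m} {k} n y k≤m = mk⇔ toAP fromAP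
  where
  toAP : SumOffset du m (k * du) (suc n) y → APOffset du (m + n * k) y
  toAP (i , j , i<m , j<1+n , refl) =
    i + j * k , +-mono-<-≤ i<m (*-monoˡ-≤ k (s≤s⁻¹ j<1+n)) , i*d+j*[k*d]≡[i+j*k]*d i j k du
  fromAP : APOffset du (m + n * k) y → SumOffset du m (k * du) (suc n) y
  fromAP (t , t< , refl) with i+j*k-cover n t k≤m t<
  ... | i , j , i<m , j≤n , refl = i , j , i<m , s≤s j≤n , sym (i*d+j*[k*d]≡[i+j*k]*d i j k du)

BoundedMultiple⇒OffsetsAP : ∀ {du m dv n} → 1 ≤ du → 2 ≤ m → 1 ≤ n →
                            BoundedMultiple m du dv → OffsetsAP du m dv n
BoundedMultiple⇒OffsetsAP {du} {m} 1≤du 2≤m (s≤s {n = n} z≤n) (k , _ , k≤m , refl) =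
  du , m + n * k , ≤-trans 2≤m (m≤m+n m (n * k)) , 1≤du , λ y → SumOffset⇔APOffset-multiple n y k≤m

OffsetsAP⇔BoundedMultiple : ∀ {du m dv n} → 1 ≤ du → 1 ≤ dv → 2 ≤ m → 2 ≤ n →
                            OffsetsAP du m dv n ⇔ (BoundedMultiple m du dv ⊎ BoundedMultiple n dv du)
OffsetsAP⇔BoundedMultiple {du} {m} {dv} {n} 1≤du 1≤dv 2≤m 2≤n = mk⇔ toMultiple fromMultiple
  where
  toMultiple : OffsetsAP du m dv n → BoundedMultiple m du dv ⊎ BoundedMultiple n dv du
  toMultiple offsetsAP with ≤-total du dv
  ... | inj₁ du≤dv = inj₁ (OffsetsAP⇒BoundedMultiple 1≤du du≤dv 2≤m 2≤n offsetsAP)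
  ... | inj₂ dv≤du = inj₂ (OffsetsAP⇒BoundedMultiple 1≤dv dv≤du 2≤n 2≤m (OffsetsAP-swap offsetsAP))
  fromMultiple : BoundedMultiple m du dv ⊎ BoundedMultiple n dv du → OffsetsAP du m dv n
  fromMultiple (inj₁ multiple) =
    BoundedMultiple⇒OffsetsAP 1≤du 2≤m (≤-trans (s≤s z≤n) 2≤n) multiple
  fromMultiple (inj₂ multiple) =
    OffsetsAP-swap (BoundedMultiple⇒OffsetsAP 1≤dv 2≤n (≤-trans (s≤s z≤n) 2≤m) multiple)

⊕-IsAPSet⇔BoundedMultiple : ∀ {A B a du m b dv n} → IsAPWith A a du m → IsAPWith B b dv n →
                            IsAPSet (A ⊕ B) ⇔
                            (BoundedMultiple ∣ A ∣ₛ du dv ⊎ BoundedMultiple ∣ B ∣ₛ dv du)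
⊕-IsAPSet⇔BoundedMultiple apA@(2≤m , 1≤du , _) apB@(2≤n , 1≤dv , _)
  rewrite ∣∣ₛ-IsAPWith apA | ∣∣ₛ-IsAPWith apB =
  OffsetsAP⇔BoundedMultiple 1≤du 1≤dv 2≤m 2≤n ⇔-∘ ⊕-IsAPSet⇔OffsetsAP apA apB

theorem2p8 : ∀ {n} (G : Graph n) (f : Fin n → FinSet) →
    IsIASI G f → IsVertexArithmetic G f →
    IsArithmetic G f ⇔
      (∀ u v → Adj G u v → ∀ du dv → HasDetIndex (f u) du → HasDetIndex (f v) dv →
        (Σ ℕ λ k → (1 ≤ k) × (k ≤ ∣ f u ∣ₛ) × (dv ≡ k * du))
        ⊎ (Σ ℕ λ k → (1 ≤ k) × (k ≤ ∣ f v ∣ₛ) × (du ≡ k * dv)))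
theorem2p8 G f _ vertexArithmetic = mk⇔
  (λ (_ , edgeArithmetic) u v uv du dv (_ , _ , apU) (_ , _ , apV) →
     to (⊕-IsAPSet⇔BoundedMultiple apU apV) (edgeArithmetic u v uv))
  (λ multiples → vertexArithmetic , λ u v uv →
     let (du , a , m , apU) = vertexArithmetic u
         (dv , b , n , apV) = vertexArithmetic v
     in from (⊕-IsAPSet⇔BoundedMultiple apU apV) (multiples u v uv du dv (a , m , apU) (b , n , apV)))
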